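{- Fix a truth-value structure $\mathbf{B}$ (three-valued or two-valued). Let $\Gamma$ be a context, $T$ a table, $c$ a condition, $\sigma_1,\sigma_2,\tau,\tau'$ schemas, $\vec{t{:}x}$ and $\vec{u{:}y}$ select lists, and let $S,S'$ be evaluations such that $$[\![\Gamma\vdash \mathtt{SELECT}~\vec{t{:}x}~\mathtt{FROM}~\mathit{query}\,(\mathtt{SELECT}~\vec{u{:}y}~\mathtt{FROM}~T{:}\sigma_2~\mathtt{WHERE}~c){:}\sigma_1~\mathtt{WHERE}~\mathtt{TRUE} : \tau]\!]^{\mathbf{B}}\Downarrow S,$$ $$[\![\Gamma\vdash \mathtt{SELECT}~(\vec{t{:}x})[0.\sigma_1 := \vec u]~\mathtt{FROM}~T{:}\sigma_2~\mathtt{WHERE}~c : \tau']\!]^{\mathbf{B}}\Downarrow S'.$$ Then for every environment $\eta$ for $\Gamma$, $S\,\eta$ and $S'\,\eta$ are (heterogeneously) equal, i.e. they are the same multiset of tuples.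
   Context: If $\sigma_1=x_1,\dots,x_k$ and $\vec u=u_1,\dots,u_k$, the substitution $(\vec{t{:}x})[0.\sigma_1:=\vec u]$ replaces, in each term of the select list (names unchanged), the term $0.x_i$ by $u_i$ ($i=1,\dots,k$) and leaves other terms unchanged. Terms are $n.x$ (de Bruijn index $n$ into the context, name $x$), constants, or NULL. The semantics is as follows. Values are constants or NULL. A schema is a finite list of names; a context is a finite list of schemas. Tables are $\mathit{table}~x$ (a stored table of a database, which assigns to some names $x$ a schema $D(x)$ and a finite multiset $D_{rel}(x)$ of $|D(x)|$-tuples) or $\mathit{query}~Q$. Relations are finite multisets of tuples, with $\times$ (product), $\sigma_p$ (filter), $\sum_{v\leftarrow r} f(v)$ (comprehension: $\#(\cdot,w)=\sum_{v:f(v)=w}\#(r,v)$), $\|\cdot\|$ (deduplication). An environment for $\Gamma=\sigma_1,\dots,\sigma_k$ is a list of value lists of lengths $|\sigma_i|$; $[\Gamma'\mapsto v]$ splits a tuple $v$ into an environment for $\Gamma'$, and $\mathbin{++}$ concatenates environments. Term semantics: $n.x$ in context $\Gamma$ evaluates (only if $x$ occurs exactly once in $\Gamma(n)$) to the entry of the $n$-th list of the environment at the position of $x$ in $\Gamma(n)$; constants/NULL evaluate to themselves. Tables: $\mathit{table}~x$ evaluates to $D_{rel}(x)$ with schema $D(x)$; $\mathit{query}~Q$ to the evaluation of $Q$. A FROM list $T_1{:}\rho_1,\dots,T_l{:}\rho_l$ in $\Gamma$ evaluates, when each $T_i$ evaluates with a schema of length $|\rho_i|$, to the context $\Gamma'=\rho_1,\dots,\rho_l$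 and $\eta\mapsto$ the product of the $T_i$'s evaluations. A query $\mathtt{SELECT}~\vec{t{:}x}~\mathtt{FROM}~\vec{T{:}\rho}~\mathtt{WHERE}~c$ in $\Gamma$ has schema $\vec x$ and evaluates (when the FROM list evaluates to $\Gamma',S_F$ and $c$, $\vec t$ evaluate to $S_c,S_t$ in context $\Gamma',\Gamma$) to $\eta\mapsto\sum_{v\leftarrow\sigma_p(S_F\eta)} S_t([\Gamma'\mapsto v]\mathbin{++}\eta)$, with $p(v)$ true iff $S_c([\Gamma'\mapsto v]\mathbin{++}\eta)$ is the truth value btrue. The condition $\mathtt{TRUE}$ evaluates to btrue; conditions in general evaluate to functions from environments to $\mathbf{B}$, where $\mathbf{B}$ is either Kleene three-valued logic or Boolean logic (semantics of general conditions as standard for SQL with nulls: comparisons involving NULL yield the unknown value, which is identified with false in the Boolean case). -}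

module Defs where

open import Data.Bool using (Bool; true; false; if_then_else_; not; _∧_; _∨_)
open import Data.Nat using (ℕ; zero; suc; _+_)
open import Data.Fin using (Fin)
open import Data.List using (List; []; _∷_; length; map; concat; concatMap; filterᵇ; deduplicate; zip; foldr; null; _++_)
open import Data.List.Properties using (length-++)
open import Data.Vec using (Vec; []; _∷_; take; drop; toList) renaming (_++_ to _++ᵥ_; lookup to lookupᵥ)
import Data.Vec.Properties as VecP
open import Data.Maybe using (Maybe; just; nothing)
open import Data.Product using (Σ; _×_; _,_; proj₁; proj₂)
open import Relation.Nullary using (Dec; yes; no; does)
open import Relation.Binary.Definitions using (DecidableEquality)
open import Relation.Binary.PropositionalEquality using (_≡_; refl; subst; cong; cong₂)
import Data.List as L

data Tri : Set where
  ttt fff uuu : Tri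

record TV : Set₁ where
  field
    Carrier  : Set
    btrue    : Carrier
    bfalse   : Carrier
    bunknown : Carrier
    band     : Carrier → Carrier → Carrier
    bor      : Carrier → Carrier → Carrier
    bneg     : Carrier → Carrier
    isBtrue  : Carrier → Bool

  ofBool : Bool → Carrier
  ofBool b = if b then btrue else bfalse

kleene : TV
kleene = record
  { Carrier = Tri ; btrue = ttt ; bfalse = fff ; bunknown = uuu
  ; band = kand ; bor = kor ; bneg = kneg ; isBtrue = isT }
  where
  kand : Tri → Tri → Tri
  kand fff _ = fff
  kand _ fff = fff
  kand ttt ttt = ttt
  kand _ _ = uuu
  kor : Tri → Tri → Tri
  kor ttt _ = ttt
  kor _ ttt = ttt
  kor fff fff = fff
  kor _ _ = uuu
  kneg : Tri → Tri
  kneg ttt = fff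
  kneg fff = ttt
  kneg uuu = uuu
  isT : Tri → Bool
  isT ttt = true
  isT _ = false

boolean : TV
boolean = record
  { Carrier = Bool ; btrue = true ; bfalse = false ; bunknown = false
  ; band = _∧_ ; bor = _∨_ ; bneg = not ; isBtrue = λ b → b }

data Logic : Set where
  threeValued twoValued : Logic

tvOf : Logic → TV
tvOf threeValued = kleene
tvOf twoValued   = boolean

record Sig : Set₁ where
  field
    Name    : Set
    _≟N_    : DecidableEquality Name
    Const   : Set
    _≟C_    : DecidableEquality Const
    Pred    : Set
    arity   : Pred → ℕ
    interp  : (P : Pred) → Vec Const (arity P) → Bool

module SQL (sig : Sig) where
  open Sig sig

  data Value : Set where
    val  : Const → Value
    NULL : Value

  _≟V_ : DecidableEquality Value
  val a ≟V val b with a ≟C b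
  ... | yes refl = yes refl
  ... | no ne = no λ { refl → ne refl }
  val _ ≟V NULL = no λ ()
  NULL ≟V val _ = no λ ()
  NULL ≟V NULL = yes refl

  Schema : Set
  Schema = List Name

  Ctx : Set
  Ctx = List Schema

  size : Ctx → ℕ
  size [] = 0
  size (ρ ∷ Γ) = length ρ + size Γ

  Tuple : ℕ → Set
  Tuple n = Vec Value n

  -- relations: finite multisets of n-tuples, represented as lists
  -- (multiset equality = permutation)
  Rel : ℕ → Set
  Rel n = List (Tuple n)

  data Env : Ctx → Set where
    emp  : Env []
    _∷ₑ_ : ∀ {s Γ} → Tuple (length s) → Env Γ → Env (s ∷ Γ)

  headₑ : ∀ {s Γ} → Env (s ∷ Γ) → Tuple (length s)
  headₑ (v ∷ₑ _) = v

  tailₑ : ∀ {s Γ} → Env (s ∷ Γ) → Env Γ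
  tailₑ (_ ∷ₑ η) = η

  split : (Γ : Ctx) → Tuple (size Γ) → Env Γ
  split [] _ = emp
  split (ρ ∷ Γ) v = take (length ρ) v ∷ₑ split Γ (drop (length ρ) v)

  _++ₑ_ : ∀ {Γ Δ} → Env Γ → Env Δ → Env (Γ ++ Δ)
  emp ++ₑ η = η
  (v ∷ₑ η) ++ₑ η' = v ∷ₑ (η ++ₑ η')

  castR : ∀ {m n} → m ≡ n → Rel m → Rel n
  castR e = subst Rel e

  prod : ∀ {m n} → Rel m → Rel n → Rel (m + n)
  prod r s = concatMap (λ v → map (v ++ᵥ_) s) r

  dedup : ∀ {n} → Rel n → Rel n
  dedup = deduplicate (VecP.≡-dec _≟V_)

  remove1 : ∀ {n} → Tuple n → Rel n → Rel n
  remove1 v [] = []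
  remove1 v (w ∷ r) = if does (VecP.≡-dec _≟V_ v w) then r else w ∷ remove1 v r

  member : ∀ {n} → Tuple n → Rel n → Bool
  member v [] = false
  member v (w ∷ r) = does (VecP.≡-dec _≟V_ v w) ∨ member v r

  monus : ∀ {n} → Rel n → Rel n → Rel n
  monus r [] = r
  monus r (w ∷ s) = monus (remove1 w r) s

  inter : ∀ {n} → Rel n → Rel n → Rel n
  inter [] s = []
  inter (v ∷ r) s = if member v s then v ∷ inter r (remove1 v s) else inter r s

  size-concat : (Γ : Ctx) → size Γ ≡ length (concat Γ)
  size-concat [] = refl
  size-concat (ρ ∷ Γ) rewrite length-++ ρ {concat Γ} = cong (length ρ +_) (size-concat Γ)

  data Term : Set where
    var  : ℕ → Name → Term
    cst  : Const → Term
    nul  : Term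

  data Quant : Set where
    ALL DISTINCT : Quant

  data Query : Set
  data Table : Set
  data Cond  : Set

  data Query where
    -- SELECT [DISTINCT] t⃗:x⃗ FROM T⃗:ρ⃗ WHERE c
    select     : Quant → List (Term × Name) → List (Table × Schema) → Cond → Query
    -- SELECT [DISTINCT] * FROM T⃗:ρ⃗ WHERE c
    selectStar : Quant → List (Table × Schema) → Cond → Query
    union intersect except : Quant → Query → Query → Query

  data Table where
    table : Name → Table
    query : Query → Table

  data Cond where
    TRUE FALSE : Cond
    AND OR     : Cond → Cond → Cond
    NOT        : Cond → Cond
    isNull     : Term → Cond
    pred       : (P : Pred) → Vec Term (arity P) → Cond
    IN         : List Term → Query → Cond
    EXISTS     : Query → Cond

  lookupSub : Name → List (Name × Term) → Term
  lookupSub x [] = var 0 x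
  lookupSub x ((y , u) ∷ ρ) = if does (x ≟N y) then u else lookupSub x ρ

  substTm : List (Name × Term) → Term → Term
  substTm ρ (var zero x) = lookupSub x ρ
  substTm ρ t = t

  substSel : List (Term × Name) → Schema → List Term → List (Term × Name)
  substSel sl σ us = map (λ { (t , x) → (substTm (zip σ us) t , x) }) sl

  Database : Set
  Database = Name → Maybe (Σ Schema λ s → Rel (length s))

  -- variables: x must occur exactly once in Γ(n)
  data VarSem : (Γ : Ctx) → ℕ → Name → (Env Γ → Value) → Set where
    here  : ∀ {s Γ x} (i : Fin (length s)) → L.lookup s i ≡ x →
            (∀ j → L.lookup s j ≡ x → j ≡ i) →
            VarSem (s ∷ Γ) zero x (λ η → lookupᵥ (headₑ η) i)
    there : ∀ {s Γ n x f} → VarSem Γ n x f →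
            VarSem (s ∷ Γ) (suc n) x (λ η → f (tailₑ η))

  data TmSem (Γ : Ctx) : Term → (Env Γ → Value) → Set where
    sVar  : ∀ {n x f} → VarSem Γ n x f → TmSem Γ (var n x) f
    sCst  : ∀ k → TmSem Γ (cst k) (λ _ → val k)
    sNull : TmSem Γ nul (λ _ → NULL)

  data TmsSem (Γ : Ctx) : (ts : List Term) → (Env Γ → Tuple (length ts)) → Set where
    []  : TmsSem Γ [] (λ _ → [])
    _∷_ : ∀ {t ts f g} → TmSem Γ t f → TmsSem Γ ts g → TmsSem Γ (t ∷ ts) (λ η → f η ∷ g η)

  data TmvSem (Γ : Ctx) : ∀ {n} → (ts : Vec Term n) → (Env Γ → Tuple n) → Set where
    []  : TmvSem Γ [] (λ _ → [])
    _∷_ : ∀ {n t} {ts : Vec Term n} {f g} → TmSem Γ t f → TmvSem Γ ts g →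
          TmvSem Γ (t ∷ ts) (λ η → f η ∷ g η)

  data SelSem (Γ : Ctx) : (sl : List (Term × Name)) →
                          (Env Γ → Tuple (length (map proj₂ sl))) → Set where
    []  : SelSem Γ [] (λ _ → [])
    _∷_ : ∀ {t x sl f g} → TmSem Γ t f → SelSem Γ sl g →
          SelSem Γ ((t , x) ∷ sl) (λ η → f η ∷ g η)

  dist : ∀ {n} → Quant → Rel n → Rel n
  dist ALL r = r
  dist DISTINCT r = dedup r

  module _ (B : TV) (D : Database) where
    open TV B

    allConsts : ∀ {n} → Tuple n → Maybe (Vec Const n)
    allConsts [] = just []
    allConsts (NULL ∷ _) = nothing
    allConsts (val k ∷ v) with allConsts v
    ... | just ks = just (k ∷ ks)
    ... | nothing = nothing

    semPred : (P : Pred) → Tuple (arity P) → Carrier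
    semPred P v with allConsts v
    ... | just ks = ofBool (interp P ks)
    ... | nothing = bunknown

    eqV : Value → Value → Carrier
    eqV (val a) (val b) = ofBool (does (a ≟C b))
    eqV _ _ = bunknown

    eqT : ∀ {n} → Tuple n → Tuple n → Carrier
    eqT [] [] = btrue
    eqT (a ∷ v) (b ∷ w) = band (eqV a b) (eqT v w)

    semIn : ∀ {n} → Tuple n → Rel n → Carrier
    semIn v r = foldr (λ u acc → bor (eqT v u) acc) bfalse r

    selectSem : ∀ {Γ} (Γ' : Ctx) {n} → (Env Γ → Rel (size Γ')) →
                (Env (Γ' ++ Γ) → Carrier) → (Env (Γ' ++ Γ) → Tuple n) → Env Γ → Rel n
    selectSem Γ' SF Sc St η =
      map (λ v → St (split Γ' v ++ₑ η))
          (filterᵇ (λ v → isBtrue (Sc (split Γ' v ++ₑ η))) (SF η))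

    data QSem (Γ : Ctx) : Query → (τ : Schema) → (Env Γ → Rel (length τ)) → Set
    data TSem (Γ : Ctx) : Table → (τ : Schema) → (Env Γ → Rel (length τ)) → Set
    data FSem (Γ : Ctx) : List (Table × Schema) → (Γ' : Ctx) → (Env Γ → Rel (size Γ')) → Set
    data CSem (Γ : Ctx) : Cond → (Env Γ → Carrier) → Set

    data QSem Γ where
      sSelect : ∀ {d sl FL c Γ' SF Sc St} →
        FSem Γ FL Γ' SF → CSem (Γ' ++ Γ) c Sc → SelSem (Γ' ++ Γ) sl St →
        QSem Γ (select d sl FL c) (map proj₂ sl)
             (λ η → dist d (selectSem Γ' SF Sc St η))
      sStar : ∀ {d FL c Γ' SF Sc} →
        FSem Γ FL Γ' SF → CSem (Γ' ++ Γ) c Sc →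
        QSem Γ (selectStar d FL c) (concat Γ')
             (λ η → castR (size-concat Γ')
                (dist d (filterᵇ (λ v → isBtrue (Sc (split Γ' v ++ₑ η))) (SF η))))
      sUnion : ∀ {d Q₁ Q₂ τ₁ τ₂ S₁ S₂} → QSem Γ Q₁ τ₁ S₁ → QSem Γ Q₂ τ₂ S₂ →
        (e : length τ₂ ≡ length τ₁) →
        QSem Γ (union d Q₁ Q₂) τ₁ (λ η → dist d (S₁ η ++ castR e (S₂ η)))
      sInter : ∀ {d Q₁ Q₂ τ₁ τ₂ S₁ S₂} → QSem Γ Q₁ τ₁ S₁ → QSem Γ Q₂ τ₂ S₂ →
        (e : length τ₂ ≡ length τ₁) →
        QSem Γ (intersect d Q₁ Q₂) τ₁ (λ η → dist d (inter (S₁ η) (castR e (S₂ η))))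
      sExcept : ∀ {d Q₁ Q₂ τ₁ τ₂ S₁ S₂} → QSem Γ Q₁ τ₁ S₁ → QSem Γ Q₂ τ₂ S₂ →
        (e : length τ₂ ≡ length τ₁) →
        QSem Γ (except d Q₁ Q₂) τ₁ (λ η → monus (dist d (S₁ η)) (castR e (S₂ η)))

    data TSem Γ where
      sTable : ∀ {x s r} → D x ≡ just (s , r) → TSem Γ (table x) s (λ _ → r)
      sQuery : ∀ {Q τ S} → QSem Γ Q τ S → TSem Γ (query Q) τ S

    data FSem Γ where
      []  : FSem Γ [] [] (λ _ → [] ∷ [])
      sCons : ∀ {T ρ FL τ S Γ' S'} → TSem Γ T τ S → (e : length τ ≡ length ρ) →
        FSem Γ FL Γ' S' →
        FSem Γ ((T , ρ) ∷ FL) (ρ ∷ Γ') (λ η → prod (castR e (S η)) (S' η))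

    data CSem Γ where
      sTrue  : CSem Γ TRUE (λ _ → btrue)
      sFalse : CSem Γ FALSE (λ _ → bfalse)
      sAnd   : ∀ {c₁ c₂ f g} → CSem Γ c₁ f → CSem Γ c₂ g → CSem Γ (AND c₁ c₂) (λ η → band (f η) (g η))
      sOr    : ∀ {c₁ c₂ f g} → CSem Γ c₁ f → CSem Γ c₂ g → CSem Γ (OR c₁ c₂) (λ η → bor (f η) (g η))
      sNot   : ∀ {c f} → CSem Γ c f → CSem Γ (NOT c) (λ η → bneg (f η))
      sIsNull : ∀ {t f} → TmSem Γ t f →
        CSem Γ (isNull t) (λ η → ofBool (does (f η ≟V NULL)))
      sPred  : ∀ {P ts f} → TmvSem Γ ts f → CSem Γ (pred P ts) (λ η → semPred P (f η))
      sIn    : ∀ {ts Q τ f S} → TmsSem Γ ts f → QSem Γ Q τ S → (e : length τ ≡ length ts) →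
        CSem Γ (IN ts Q) (λ η → semIn (f η) (castR e (S η)))
      sExists : ∀ {Q τ S} → QSem Γ Q τ S →
        CSem Γ (EXISTS Q) (λ η → ofBool (not (null (S η))))

{-# OPTIONS --safe #-}
module Submission where

-- Both queries keep the rows v of T satisfying c (the outer WHERE TRUE discards nothing).
-- The nested query then maps v to the subquery row w = u⃗(v) and evaluates t⃗ with the
-- columns 0.σ₁ bound to w; the inlined query evaluates t⃗[0.σ₁ := u⃗] at v. These agree
-- term by term, since a column 0.x occurring exactly once in σ₁, at position i, is read
-- from the i-th entry of w and replaced by the i-th term of u⃗. Evaluation being
-- deterministic, both derivations evaluate T and c alike, so the two results are even
-- equal as lists.

open import Defs
open import Data.Bool using (Bool; true; T; T?)
open import Data.Nat using (suc)
open import Data.Nat.Properties using (≡-irrelevant; suc-injective)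
import Data.Fin as Fin
import Data.Fin.Properties as Finₚ
open import Data.List using (List; []; _∷_; _++_; length; map; filterᵇ; zip; lookup)
open import Data.List.Properties using (map-∘; map-cong; filter-≐)
open import Data.List.Relation.Binary.Permutation.Propositional using (_↭_; ↭-reflexive)
open import Data.Vec using (Vec; []; _∷_; take) renaming (_++_ to _++ᵥ_; lookup to lookupᵥ)
open import Data.Product using (Σ; _×_; _,_; proj₁; proj₂)
open import Data.Empty using (⊥-elim)
open import Function using (_∘_)
open import Relation.Nullary using (yes; no)
open import Relation.Binary.PropositionalEquality

take-++ : ∀ {A : Set} {m n} (xs : Vec A m) (ys : Vec A n) → take m (xs ++ᵥ ys) ≡ xs
take-++ []       ys = refl
take-++ (x ∷ xs) ys = cong (x ∷_) (take-++ xs ys)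

subst-∷ : ∀ {A : Set} {m n} (e : suc m ≡ suc n) (x : A) (xs : Vec A m) →
          subst (Vec A) e (x ∷ xs) ≡ x ∷ subst (Vec A) (suc-injective e) xs
subst-∷ refl x xs = refl

subst-map : ∀ {A I : Set} (F : I → Set) {i j} (e : i ≡ j) (f : A → F i) (xs : List A) →
            subst (List ∘ F) e (map f xs) ≡ map (subst F e ∘ f) xs
subst-map F refl f xs = refl

filterᵇ-cong : ∀ {A : Set} {p q : A → Bool} → (∀ x → p x ≡ q x) → ∀ xs → filterᵇ p xs ≡ filterᵇ q xs
filterᵇ-cong {p = p} {q} p≗q =
  filter-≐ (T? ∘ p) (T? ∘ q) ((λ {x} → subst T (p≗q x)) , (λ {x} → subst T (sym (p≗q x))))

Agree : ∀ {A I : Set} (F : I → Set) {i j : I} → (A → F i) → (A → F j) → Set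
Agree F {i} {j} f g = Σ (i ≡ j) λ e → ∀ a → subst F e (f a) ≡ g a

module _ (sig : Sig) where
  open SQL sig
  open Sig sig using (Name; _≟N_)

  VarSem-deterministic : ∀ {Γ n x f g} → VarSem Γ n x f → VarSem Γ n x g → ∀ η → f η ≡ g η
  VarSem-deterministic (here i _ unique) (here j x≡ _) η with unique j x≡
  ... | refl = refl
  VarSem-deterministic (there a) (there b) η = VarSem-deterministic a b (tailₑ η)

  TmSem-deterministic : ∀ {Γ t f g} → TmSem Γ t f → TmSem Γ t g → ∀ η → f η ≡ g η
  TmSem-deterministic (sVar a)  (sVar b)   η = VarSem-deterministic a b η
  TmSem-deterministic (sCst k)  (sCst .k)  η = refl
  TmSem-deterministic sNull     sNull      η = refl

  TmsSem-deterministic : ∀ {Γ ts f g} → TmsSem Γ ts f → TmsSem Γ ts g → ∀ η → f η ≡ g η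
  TmsSem-deterministic []       []       η = refl
  TmsSem-deterministic (a ∷ as) (b ∷ bs) η =
    cong₂ _∷_ (TmSem-deterministic a b η) (TmsSem-deterministic as bs η)

  TmvSem-deterministic : ∀ {Γ n} {ts : Vec Term n} {f g} →
                         TmvSem Γ ts f → TmvSem Γ ts g → ∀ η → f η ≡ g η
  TmvSem-deterministic []       []       η = refl
  TmvSem-deterministic (a ∷ as) (b ∷ bs) η =
    cong₂ _∷_ (TmSem-deterministic a b η) (TmvSem-deterministic as bs η)

  SelSem-deterministic : ∀ {Γ sl f g} → SelSem Γ sl f → SelSem Γ sl g → ∀ η → f η ≡ g η
  SelSem-deterministic []       []       η = refl
  SelSem-deterministic (a ∷ as) (b ∷ bs) η =
    cong₂ _∷_ (TmSem-deterministic a b η) (SelSem-deterministic as bs η)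

  module _ (B : TV) (D : Database) where
    open TV B

    selectSem-cong : ∀ {Γ} (Γ' : Ctx) {n} {SF SF' Sc Sc'} {St St' : Env (Γ' ++ Γ) → Tuple n} →
      (∀ η → SF η ≡ SF' η) →
      (∀ ρ → Sc ρ ≡ Sc' ρ) → (∀ ρ → St ρ ≡ St' ρ) →
      ∀ η → selectSem B D Γ' SF Sc St η ≡ selectSem B D Γ' SF' Sc' St' η
    selectSem-cong Γ' {SF' = SF'} SF≗ Sc≗ St≗ η rewrite SF≗ η =
      trans (map-cong (St≗ ∘ _) _) (cong (map _) (filterᵇ-cong (cong isBtrue ∘ Sc≗ ∘ _) (SF' η)))

    QSem-deterministic : ∀ {Γ Q τ₁ τ₂ S₁ S₂} → QSem B D Γ Q τ₁ S₁ → QSem B D Γ Q τ₂ S₂ →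
                         Agree (Rel ∘ length) {τ₁} {τ₂} S₁ S₂
    TSem-deterministic : ∀ {Γ T τ₁ τ₂ S₁ S₂} → TSem B D Γ T τ₁ S₁ → TSem B D Γ T τ₂ S₂ →
                         Agree (Rel ∘ length) {τ₁} {τ₂} S₁ S₂
    FSem-deterministic : ∀ {Γ FL Γ₁ Γ₂ S₁ S₂} → FSem B D Γ FL Γ₁ S₁ → FSem B D Γ FL Γ₂ S₂ →
                         Agree (Rel ∘ size) {Γ₁} {Γ₂} S₁ S₂
    CSem-deterministic : ∀ {Γ c f g} → CSem B D Γ c f → CSem B D Γ c g → ∀ η → f η ≡ g η

    QSem-deterministic (sSelect {d = d} {Γ' = Γ'} F C Sl) (sSelect F' C' Sl')
      with FSem-deterministic F F'
    ... | refl , SF≗ = refl , λ η → cong (dist d) (selectSem-cong Γ' SF≗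
            (CSem-deterministic C C') (SelSem-deterministic Sl Sl') η)
    QSem-deterministic (sStar {d = d} {Γ' = Γ'} {Sc = Sc} F C) (sStar {SF = SF'} F' C')
      with FSem-deterministic F F'
    ... | refl , SF≗ = refl , λ η → cong (castR (size-concat Γ') ∘ dist d)
            (trans (cong (filterᵇ _) (SF≗ η))
                   (filterᵇ-cong (λ v → cong isBtrue (CSem-deterministic C C' _)) (SF' η)))
    QSem-deterministic (sUnion {d = d} Q₁ Q₂ e) (sUnion Q₁' Q₂' e')
      with QSem-deterministic Q₁ Q₁' | QSem-deterministic Q₂ Q₂'
    ... | refl , S₁≗ | refl , S₂≗ with ≡-irrelevant e e'
    ... | refl =
      refl , λ η → cong (dist d) (cong₂ (λ r s → r ++ castR e s) (S₁≗ η) (S₂≗ η))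
    QSem-deterministic (sInter {d = d} Q₁ Q₂ e) (sInter Q₁' Q₂' e')
      with QSem-deterministic Q₁ Q₁' | QSem-deterministic Q₂ Q₂'
    ... | refl , S₁≗ | refl , S₂≗ with ≡-irrelevant e e'
    ... | refl =
      refl , λ η → cong (dist d) (cong₂ (λ r s → inter r (castR e s)) (S₁≗ η) (S₂≗ η))
    QSem-deterministic (sExcept {d = d} Q₁ Q₂ e) (sExcept Q₁' Q₂' e')
      with QSem-deterministic Q₁ Q₁' | QSem-deterministic Q₂ Q₂'
    ... | refl , S₁≗ | refl , S₂≗ with ≡-irrelevant e e'
    ... | refl =
      refl , λ η → cong₂ (λ r s → monus (dist d r) (castR e s)) (S₁≗ η) (S₂≗ η)

    TSem-deterministic (sTable p) (sTable q) with trans (sym p) q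
    ... | refl = refl , λ _ → refl
    TSem-deterministic (sQuery Q) (sQuery Q') = QSem-deterministic Q Q'

    FSem-deterministic [] [] = refl , λ _ → refl
    FSem-deterministic (sCons T e F) (sCons T' e' F')
      with TSem-deterministic T T' | FSem-deterministic F F'
    ... | refl , S≗ | refl , S'≗ with ≡-irrelevant e e'
    ... | refl =
      refl , λ η → cong₂ (λ r s → prod (castR e r) s) (S≗ η) (S'≗ η)

    CSem-deterministic sTrue  sTrue  η = refl
    CSem-deterministic sFalse sFalse η = refl
    CSem-deterministic (sAnd a b) (sAnd a' b') η =
      cong₂ band (CSem-deterministic a a' η) (CSem-deterministic b b' η)
    CSem-deterministic (sOr a b) (sOr a' b') η =
      cong₂ bor (CSem-deterministic a a' η) (CSem-deterministic b b' η)
    CSem-deterministic (sNot a) (sNot a') η = cong bneg (CSem-deterministic a a' η)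
    CSem-deterministic (sIsNull t) (sIsNull t') η rewrite TmSem-deterministic t t' η = refl
    CSem-deterministic (sPred ts) (sPred ts') η rewrite TmvSem-deterministic ts ts' η = refl
    CSem-deterministic (sIn ts Q e) (sIn ts' Q' e') η with QSem-deterministic Q Q'
    ... | refl , S≗ with ≡-irrelevant e e'
    ... | refl rewrite TmsSem-deterministic ts ts' η | S≗ η = refl
    CSem-deterministic (sExists Q) (sExists Q') η with QSem-deterministic Q Q'
    ... | refl , S≗ rewrite S≗ η = refl

    selectSem-single-TRUE : isBtrue btrue ≡ true →
      ∀ {Γ σ n} (R : Env Γ → Rel (length σ)) (St : Env (σ ∷ Γ) → Tuple n) η →
      selectSem B D (σ ∷ []) (λ η → prod (R η) ([] ∷ [])) (λ _ → btrue) St η ≡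
      map (λ w → St (w ∷ₑ η)) (R η)
    selectSem-single-TRUE passes {σ = σ} R St η = go (λ _ → passes) (R η)
      where
      go : ∀ {p} → (∀ v → p v ≡ true) → ∀ rows →
           map (λ v → St (take (length σ) v ∷ₑ η)) (filterᵇ p (prod rows ([] ∷ [])))
           ≡ map (λ w → St (w ∷ₑ η)) rows
      go all []         = refl
      go all (w ∷ rows) rewrite all (w ++ᵥ []) =
        cong₂ _∷_ (cong (λ u → St (u ∷ₑ η)) (take-++ w [])) (go all rows)

  substSel-names : ∀ tx σ us → map proj₂ (substSel tx σ us) ≡ map proj₂ tx
  substSel-names []            σ us = refl
  substSel-names ((t , x) ∷ tx) σ us = cong (x ∷_) (substSel-names tx σ us)

  lookupSub-sem : ∀ {Δ} σ uy {Su} → SelSem Δ uy Su → (e : length (map proj₂ uy) ≡ length σ) →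
    ∀ i x → lookup σ i ≡ x → (∀ j → lookup σ j ≡ x → j ≡ i) →
    ∀ {f} → TmSem Δ (lookupSub x (zip σ (map proj₁ uy))) f →
    ∀ ρ → f ρ ≡ lookupᵥ (subst Tuple e (Su ρ)) i
  lookupSub-sem [] _ _ _ () _ _ _ _ _
  lookupSub-sem (y ∷ σ) [] [] () _ _ _ _ _ _
  lookupSub-sem (y ∷ σ) ((u , _) ∷ uy) (a ∷ as) e i x y≡x unique t ρ with x ≟N y | i
  ... | yes _   | Fin.zero =
    trans (TmSem-deterministic t a ρ) (cong (λ w → lookupᵥ w Fin.zero) (sym (subst-∷ e _ _)))
  ... | yes x≡y | Fin.suc _ with unique Fin.zero (sym x≡y)
  ...   | ()
  lookupSub-sem (y ∷ σ) (_ ∷ uy) (a ∷ as) e i x y≡x unique t ρ | no x≢y | Fin.zero =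
    ⊥-elim (x≢y (sym y≡x))
  lookupSub-sem (y ∷ σ) (_ ∷ uy) (a ∷ as) e i x y≡x unique t ρ | no x≢y | Fin.suc i' =
    trans (lookupSub-sem σ uy as (suc-injective e) i' x y≡x
             (λ j p → Finₚ.suc-injective (unique (Fin.suc j) p)) t ρ)
          (cong (λ w → lookupᵥ w (Fin.suc i')) (sym (subst-∷ e _ _)))

  -- w is the row of the subquery produced by the row v of T.
  module _ {Γ : Ctx} {σ₁ σ₂ : Schema} {uy : List (Term × Name)} {Su} (selU : SelSem (σ₂ ∷ Γ) uy Su)
           (e : length (map proj₂ uy) ≡ length σ₁) (v : Tuple (length σ₂)) (η : Env Γ) where

    private
      w : Tuple (length σ₁)
      w = subst Tuple e (Su (v ∷ₑ η))

      us : List Term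
      us = map proj₁ uy

    substTm-sem : ∀ {t f f'} → TmSem (σ₁ ∷ Γ) t f → TmSem (σ₂ ∷ Γ) (substTm (zip σ₁ us) t) f' →
                  f (w ∷ₑ η) ≡ f' (v ∷ₑ η)
    substTm-sem (sVar (here i x≡ unique)) t' = sym (lookupSub-sem σ₁ uy selU e i _ x≡ unique t' _)
    substTm-sem (sVar (there a)) (sVar (there b)) = VarSem-deterministic a b η
    substTm-sem (sCst k) (sCst .k) = refl
    substTm-sem sNull    sNull     = refl

    substSel-sem : ∀ {tx St St'} → SelSem (σ₁ ∷ Γ) tx St → SelSem (σ₂ ∷ Γ) (substSel tx σ₁ us) St' →
      (E : length (map proj₂ tx) ≡ length (map proj₂ (substSel tx σ₁ us))) →
      subst Tuple E (St (w ∷ₑ η)) ≡ St' (v ∷ₑ η)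
    substSel-sem []       []       refl = refl
    substSel-sem (a ∷ as) (b ∷ bs) E =
      trans (subst-∷ E _ _) (cong₂ _∷_ (substTm-sem a b) (substSel-sem as bs _))

  module _ (B : TV) (D : Database) (passes : TV.isBtrue B (TV.btrue B) ≡ true) where
    open TV B using (isBtrue; btrue)

    select-subquery-inline : ∀ (Γ : Ctx) (T : Table) (c : Cond)
      (σ₁ σ₂ τ τ' : Schema) (tx uy : List (Term × Name))
      (S : Env Γ → Rel (length τ)) (S' : Env Γ → Rel (length τ')) →
      QSem B D Γ
        (select ALL tx ((query (select ALL uy ((T , σ₂) ∷ []) c) , σ₁) ∷ []) TRUE) τ S →
      QSem B D Γ
        (select ALL (substSel tx σ₁ (map proj₁ uy)) ((T , σ₂) ∷ []) c) τ' S' →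
      Agree Rel {length τ} {length τ'} S S'
    select-subquery-inline Γ T c σ₁ σ₂ _ _ tx uy _ _
      (sSelect {St = St} (sCons (sQuery (sSelect {SF = SF} {Sc = Sc} {St = Su} F@(sCons _ _ []) C selU)) e []) sTrue selT)
      (sSelect {St = St'} F' C' selT')
      with FSem-deterministic B D F F'
    ... | refl , SF≗ = E , λ η → begin
      subst Rel E (selectSem B D (σ₁ ∷ []) (λ η → prod (R η) ([] ∷ [])) (λ _ → btrue) St η)
        ≡⟨ cong (subst Rel E) (selectSem-single-TRUE B D passes R St η) ⟩
      subst Rel E (map (λ w → St (w ∷ₑ η)) (subst Rel e (map (inner η) (rows η))))
        ≡⟨ cong (subst Rel E ∘ map _) (subst-map Tuple e (inner η) (rows η)) ⟩
      subst Rel E (map (λ w → St (w ∷ₑ η)) (map (subst Tuple e ∘ inner η) (rows η)))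
        ≡⟨ cong (subst Rel E) (sym (map-∘ (rows η))) ⟩
      subst Rel E (map (λ v → St (subst Tuple e (inner η v) ∷ₑ η)) (rows η))
        ≡⟨ subst-map Tuple E _ (rows η) ⟩
      selectSem B D (σ₂ ∷ []) SF Sc Stᵢ η
        ≡⟨ selectSem-cong B D (σ₂ ∷ []) {St = Stᵢ} {St'} SF≗ (CSem-deterministic B D C C')
             (λ { (v ∷ₑ η') → substSel-sem selU e v η' selT selT' E }) η ⟩
      _ ∎
      where
      open ≡-Reasoning

      E : length (map proj₂ tx) ≡ length (map proj₂ (substSel tx σ₁ (map proj₁ uy)))
      E = cong length (sym (substSel-names tx σ₁ (map proj₁ uy)))

      R : Env Γ → Rel (length σ₁)
      R η = subst Rel e (selectSem B D (σ₂ ∷ []) SF Sc Su η)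

      rows : Env Γ → Rel (size (σ₂ ∷ []))
      rows η = filterᵇ (λ v → isBtrue (Sc (take (length σ₂) v ∷ₑ η))) (SF η)

      inner : Env Γ → Tuple (size (σ₂ ∷ [])) → Tuple (length (map proj₂ uy))
      inner η v = Su (take (length σ₂) v ∷ₑ η)

      Stᵢ : Env (σ₂ ∷ Γ) → Tuple (length (map proj₂ (substSel tx σ₁ (map proj₁ uy))))
      Stᵢ ρ = subst Tuple E (St (subst Tuple e (Su ρ) ∷ₑ tailₑ ρ))

isBtrue-btrue : ∀ L → TV.isBtrue (tvOf L) (TV.btrue (tvOf L)) ≡ true
isBtrue-btrue threeValued = refl
isBtrue-btrue twoValued   = refl

theorem2 : (sig : Sig) → let open SQL sig in
    (L : Logic) (D : Database) (Γ : Ctx) (T : Table) (c : Cond)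
    (σ₁ σ₂ τ τ' : Schema) (tx uy : List (Term × Sig.Name sig))
    (S : Env Γ → Rel (length τ)) (S' : Env Γ → Rel (length τ')) →
    QSem (tvOf L) D Γ
      (select ALL tx ((query (select ALL uy ((T , σ₂) ∷ []) c) , σ₁) ∷ []) TRUE) τ S →
    QSem (tvOf L) D Γ
      (select ALL (substSel tx σ₁ (map proj₁ uy)) ((T , σ₂) ∷ []) c) τ' S' →
    Σ (length τ ≡ length τ') (λ e → (η : Env Γ) → subst Rel e (S η) ↭ S' η)
theorem2 sig L D Γ T c σ₁ σ₂ τ τ' tx uy S S' outer inlined
  with select-subquery-inline sig (tvOf L) D (isBtrue-btrue L) Γ T c σ₁ σ₂ τ τ' tx uy S S' outer inlined
... | e , S≡S' = e , ↭-reflexive ∘ S≡S'
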